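{- If $E$ is a clopen graph on $\omega^\omega$, then ${\rm rank}(E)<\omega_1$; that is, there is a countable ordinal $\alpha$ such that ${\rm rank}_E(C\times D)\le\alpha$ for all disjoint clopen sets $C,D\subseteq\omega^\omega$.
   Context: A clopen graph on $\omega^\omega$ is a symmetric irreflexive set $E\subseteq\omega^\omega\times\omega^\omega$ that is clopen relative to $(\omega^\omega)^2\setminus\{(x,x):x\in\omega^\omega\}$. For $R\subseteq\omega^\omega\times\omega^\omega$, clopen $C,D\subseteq\omega^\omega$ and an ordinal $\alpha$: ${\rm rank}_R(C\times D)=0$ iff $C\times D\subseteq R$ or $R\cap(C\times D)=\emptyset$; ${\rm rank}_R(C\times D)\leq\alpha$ iff there are partitions $C=\bigsqcup_{i<\omega}C_i$, $D=\bigsqcup_{j<\omega}D_j$ into clopen sets (empty pieces allowed) with ${\rm rank}_R(C_i\times D_j)<\alpha$ for all $i,j$; ${\rm rank}_R(C\times D)$ is the least such $\alpha$. For a clopen graph $E$ on $\omega^\omega$, ${\rm rank}(E)=\sup\{{\rm rank}_E(C\times D): C,D \text{ disjoint clopen subsets of }\omega^\omega\}$. -}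

module Defs where

open import Level using (0ℓ; Lift)
import Level
open import Data.Nat using (ℕ; _<_)
open import Data.Product using (Σ; ∃; _×_)
open import Data.Sum using (_⊎_)
open import Data.Empty using (⊥)
open import Relation.Nullary using (¬_)
open import Relation.Binary.PropositionalEquality using (_≡_)

Baire : Set
Baire = ℕ → ℕ

Subset : Set₁
Subset = Baire → Set

Rel₂ : Set₁
Rel₂ = Baire → Baire → Set

-- x and y agree on their first n coordinates (same basic open nbhd N_{x|n})
Agree : ℕ → Baire → Baire → Set
Agree n x y = ∀ i → i < n → x i ≡ y i

_≈_ : Baire → Baire → Set
x ≈ y = ∀ i → x i ≡ y i

IsOpen : Subset → Set
IsOpen U = ∀ x → U x → ∃ λ n → ∀ y → Agree n x y → U y

IsClopen : Subset → Set
IsClopen C = IsOpen C × IsOpen (λ x → ¬ C x)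

Disjoint : Subset → Subset → Set
Disjoint C D = ∀ x → C x → D x → ⊥

-- open relative to the off-diagonal {(x,y) : x ≠ y} of (ω^ω)²
IsRelOpenOffDiag : Rel₂ → Set
IsRelOpenOffDiag R =
  ∀ x y → ¬ (x ≈ y) → R x y →
    ∃ λ n → ∀ x' y' → Agree n x x' → Agree n y y' → ¬ (x' ≈ y') → R x' y'

IsClopenGraph : Rel₂ → Set
IsClopenGraph E =
  (∀ x y → E x y → E y x) ×
  (∀ x → ¬ E x x) ×
  IsRelOpenOffDiag E ×
  IsRelOpenOffDiag (λ x y → ¬ E x y)

-- P is a partition of C into countably many clopen pieces (empty pieces allowed)
IsClopenPartition : Subset → (ℕ → Subset) → Set
IsClopenPartition C P =
  (∀ i → IsClopen (P i)) ×
  (∀ x → C x → ∃ λ i → P i x) ×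
  (∀ i x → P i x → C x) ×
  (∀ i j x → P i x → P j x → i ≡ j)

-- Brouwer trees: codes for countable ordinals (lim f denotes sup_n f n)
data Ord : Set where
  zero : Ord
  suc  : Ord → Ord
  lim  : (ℕ → Ord) → Ord

-- rank_R(C × D) = 0
Homogeneous : Rel₂ → Subset → Subset → Set
Homogeneous R C D =
  (∀ x y → C x → D y → R x y) ⊎ (∀ x y → C x → D y → ¬ R x y)

Lift₁ : Set → Set₁
Lift₁ A = Lift (Level.suc 0ℓ) A

-- RankLe R α C D : rank_R(C × D) ≤ α ;  RankLt R α C D : rank_R(C × D) < α
-- (≤ α: either rank 0, or split into clopen partitions with all pieces of rank < α)
RankLe : Rel₂ → Ord → Subset → Subset → Set₁
RankLt : Rel₂ → Ord → Subset → Subset → Set₁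

RankLe R α C D =
  Lift₁ (Homogeneous R C D) ⊎
  Σ (ℕ → Subset) λ P → Σ (ℕ → Subset) λ Q →
    Lift₁ (IsClopenPartition C P) × Lift₁ (IsClopenPartition D Q) ×
    (∀ i j → RankLt R α (P i) (Q j))

RankLt R zero    C D = Lift₁ ⊥
RankLt R (suc β) C D = RankLe R β C D
RankLt R (lim f) C D = Σ ℕ λ n → RankLt R (f n) C D

-- Call a pair of cylinders N_{a|ℓ} × N_{b|ℓ} resolved if it is E-homogeneous or every pair of
-- one-step extensions is resolved; the well-founded resolution tree is countably branching, so
-- its height is a Brouwer tree bounding rank_E on every clopen rectangle inside the pair.
-- Incompatible cylinders are always resolved: otherwise dependent choice gives a branch of
-- unresolved pairs shrinking to two distinct points x ≠ y, and as E is clopen off the diagonal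
-- the pair on the branch is eventually homogeneous. Disjoint clopen C and D split into the layers
-- Layer C i (points whose cylinder first lies inside C at level i); refining layer i of C and
-- layer j of D down to level i ⊔ j leaves only pairs of cylinders that are incompatible or meet
-- no pair of points of the layers, so countably many ordinals bound everything.
module Submission where

open import Defs
open import Level using (0ℓ; lift)
import Level
open import Function using (const; _∘_)
open import Data.Nat using (ℕ; zero; suc; _+_; _<_; _≤_; _⊔_; z≤n; s≤s; _≟_; _≤′_; ≤′-reflexive; ≤′-step)
open import Data.Nat.Properties
  using (≤-refl; ≤-trans; ≤-reflexive; ≤-total; <-≤-trans; <-irrefl; <-cmp; n≤1+n; m≤m+n; m≤n+m;
         m≤m⊔n; m≤n⊔m; +-suc; +-monoˡ-≤; ≤⇒≤′; ≤′⇒≤; m<1+n⇒m<n∨m≡n)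
open import Data.Product using (Σ; ∃; ∃₂; _×_; _,_; proj₁; proj₂)
open import Data.Sum using (_⊎_; inj₁; inj₂; [_,_]′)
open import Data.Empty using (⊥; ⊥-elim)
open import Relation.Nullary using (¬_; yes; no)
open import Relation.Nullary.Decidable using (decidable-stable)
open import Relation.Binary using (tri<; tri≈; tri>)
open import Relation.Binary.PropositionalEquality using (_≡_; refl; sym; trans)
open import Axiom.ExcludedMiddle using (ExcludedMiddle)

agree-refl : ∀ {n x} → Agree n x x
agree-refl _ _ = refl

agree-sym : ∀ {n x y} → Agree n x y → Agree n y x
agree-sym xy i i<n = sym (xy i i<n)

agree-trans : ∀ {n x y z} → Agree n x y → Agree n y z → Agree n x z
agree-trans xy yz i i<n = trans (xy i i<n) (yz i i<n)

agree-mono : ∀ {m n x y} → m ≤ n → Agree n x y → Agree m x y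
agree-mono m≤n xy i i<m = xy i (<-≤-trans i<m m≤n)

≈⇒agree : ∀ {n x y} → x ≈ y → Agree n x y
≈⇒agree x≈y i _ = x≈y i

agree-separated : ∀ {m a b x y} → ¬ Agree m a b → Agree m a x → Agree m b y → ¬ Agree m x y
agree-separated ¬ab ax by xy = ¬ab (agree-trans ax (agree-trans xy (agree-sym by)))

_[_]≔_ : Baire → ℕ → ℕ → Baire
(a [ ℓ ]≔ i) k with k ≟ ℓ
... | yes _ = i
... | no  _ = a k

[]≔-agree : ∀ {ℓ a i} → Agree ℓ a (a [ ℓ ]≔ i)
[]≔-agree {ℓ} k k<ℓ with k ≟ ℓ
... | yes refl = ⊥-elim (<-irrefl refl k<ℓ)
... | no  _    = refl

[]≔-at : ∀ {ℓ a i} → (a [ ℓ ]≔ i) ℓ ≡ i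
[]≔-at {ℓ} with ℓ ≟ ℓ
... | yes _   = refl
... | no  ℓ≢ℓ = ⊥-elim (ℓ≢ℓ refl)

[]≔-extend : ∀ {ℓ a x} → Agree ℓ a x → Agree (suc ℓ) (a [ ℓ ]≔ x ℓ) x
[]≔-extend {ℓ} {a} {x} ax k k<1+ℓ with m<1+n⇒m<n∨m≡n k<1+ℓ
... | inj₁ k<ℓ  = trans (sym ([]≔-agree {a = a} k k<ℓ)) (ax k k<ℓ)
... | inj₂ refl = []≔-at {ℓ} {a} {x ℓ}

Invariant : ℕ → Subset → Set
Invariant n P = ∀ {x y} → Agree n x y → P x → P y

invariant⇒clopen : ∀ {n P} → Invariant n P → IsClopen P
invariant⇒clopen {n} inv =
  (λ _ Px → n , λ _ xy → inv xy Px) ,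
  (λ _ ¬Px → n , λ _ xy Py → ¬Px (inv (agree-sym xy) Py))

clopen-agree : ∀ {n a} → IsClopen (Agree n a)
clopen-agree = invariant⇒clopen (λ xy ax → agree-trans ax xy)

_∩_ : Subset → Subset → Subset
(X ∩ Y) x = X x × Y x

Homogeneous-⊆ : ∀ {R C D C′ D′} → Homogeneous R C D →
                (∀ x → C′ x → C x) → (∀ y → D′ y → D y) → Homogeneous R C′ D′
Homogeneous-⊆ (inj₁ all)  C′⊆C D′⊆D = inj₁ λ x y x∈ y∈ → all x y (C′⊆C x x∈) (D′⊆D y y∈)
Homogeneous-⊆ (inj₂ none) C′⊆C D′⊆D = inj₂ λ x y x∈ y∈ → none x y (C′⊆C x x∈) (D′⊆D y y∈)

supSuc : (ℕ → ℕ → Ord) → Ord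
supSuc β = lim λ i → lim λ j → suc (β i j)

RankLe-partition : ∀ {R C D P Q β} → IsClopenPartition C P → IsClopenPartition D Q →
                   (∀ i j → RankLe R (β i j) (P i) (Q j)) → RankLe R (supSuc β) C D
RankLe-partition P-part Q-part rank = inj₂ (_ , _ , lift P-part , lift Q-part , λ i j → i , j , rank i j)

Interior : Subset → ℕ → Subset
Interior C n x = ∀ y → Agree n x y → C y

Layer : Subset → ℕ → Subset
Layer C zero      = Interior C zero
Layer C (suc n) x = Interior C (suc n) x × ¬ Interior C n x

Interior⇒∈ : ∀ {C n x} → Interior C n x → C x
Interior⇒∈ int = int _ agree-refl

Interior-mono : ∀ {C m n x} → m ≤ n → Interior C m x → Interior C n x
Interior-mono m≤n int y xy = int y (agree-mono m≤n xy)

Interior-invariant : ∀ {C} n → Invariant n (Interior C n)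
Interior-invariant _ xy int z yz = int z (agree-trans xy yz)

Layer-invariant : ∀ {C} n → Invariant n (Layer C n)
Layer-invariant zero = Interior-invariant zero
Layer-invariant (suc n) xy (int , ¬int) =
  Interior-invariant (suc n) xy int ,
  ¬int ∘ Interior-invariant n (agree-mono (n≤1+n n) (agree-sym xy))

Layer⇒Interior : ∀ {C} n {x} → Layer C n x → Interior C n x
Layer⇒Interior zero    int       = int
Layer⇒Interior (suc n) (int , _) = int

Layer-least : ∀ {C i} j {x} → Layer C j x → i < j → ¬ Interior C i x
Layer-least (suc j) (_ , ¬int) (s≤s i≤j) = ¬int ∘ Interior-mono i≤j

Layer-unique : ∀ {C x} i j → Layer C i x → Layer C j x → i ≡ j
Layer-unique i j Li Lj with <-cmp i j
... | tri< i<j _ _ = ⊥-elim (Layer-least j Lj i<j (Layer⇒Interior i Li))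
... | tri≈ _ i≡j _ = i≡j
... | tri> _ _ j<i = ⊥-elim (Layer-least i Li j<i (Layer⇒Interior j Lj))

Coherent : ℕ → (ℕ → Baire) → Set
Coherent ℓ p = ∀ n → Agree (n + ℓ) (p n) (p (suc n))

diagonal : (ℕ → Baire) → Baire
diagonal p k = p (suc k) k

coherent-agree : ∀ {ℓ p n m} → Coherent ℓ p → n ≤ m → Agree (n + ℓ) (p n) (p m)
coherent-agree {ℓ} {p} {n} coh = go ∘ ≤⇒≤′
  where
  go : ∀ {m} → n ≤′ m → Agree (n + ℓ) (p n) (p m)
  go (≤′-reflexive refl)    = agree-refl
  go {suc m} (≤′-step n≤′m) =
    agree-trans (go n≤′m) (agree-mono (+-monoˡ-≤ ℓ (≤′⇒≤ n≤′m)) (coh m))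

diagonal-agree : ∀ {ℓ p} → Coherent ℓ p → ∀ n → Agree (n + ℓ) (p n) (diagonal p)
diagonal-agree {ℓ} coh n k k<n+ℓ with ≤-total n (suc k)
... | inj₁ n≤1+k = coherent-agree coh n≤1+k k k<n+ℓ
... | inj₂ 1+k≤n = sym (coherent-agree coh 1+k≤n k (s≤s (m≤m+n k ℓ)))

relOpen-homogeneousNear :
  ∀ {R X Y} → IsRelOpenOffDiag R → ¬ X ≈ Y → R X Y → ∃ λ N → ∀ {m a b} → N ≤ m →
  ¬ Agree m a b → Agree m a X → Agree m b Y → ∀ x y → Agree m a x → Agree m b y → R x y
relOpen-homogeneousNear R-open X≉Y RXY =
  let N , near = R-open _ _ X≉Y RXY
  in N , λ N≤m ¬ab aX bY x y ax by →
       near x y (agree-mono N≤m (agree-trans (agree-sym aX) ax))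
                (agree-mono N≤m (agree-trans (agree-sym bY) by))
                (agree-separated ¬ab ax by ∘ ≈⇒agree)

module Classical (em : ExcludedMiddle 0ℓ) where

  dne : ∀ {P : Set} → ¬ ¬ P → P
  dne = decidable-stable em

  ¬∀⇒∃¬ : ∀ {P : ℕ → Set} → ¬ (∀ i → P i) → ∃ λ i → ¬ P i
  ¬∀⇒∃¬ ¬∀ = dne λ ¬∃ → ¬∀ λ i → dne λ ¬Pi → ¬∃ (i , ¬Pi)

  clopen-∩ : ∀ {X Y} → IsClopen X → IsClopen Y → IsClopen (X ∩ Y)
  clopen-∩ {X} {Y} (X-open , ¬X-open) (Y-open , ¬Y-open) = ∩-open , ∁∩-open
    where
    ∩-open : IsOpen (X ∩ Y)
    ∩-open x (x∈X , x∈Y) =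
      let m , Nm⊆X = X-open x x∈X
          n , Nn⊆Y = Y-open x x∈Y
      in m ⊔ n , λ y xy → Nm⊆X y (agree-mono (m≤m⊔n m n) xy) , Nn⊆Y y (agree-mono (m≤n⊔m m n) xy)
    ∁∩-open : IsOpen (λ x → ¬ (X ∩ Y) x)
    ∁∩-open x x∉X∩Y with em {X x}
    ... | yes x∈X = let n , N⊆∁Y = ¬Y-open x (λ x∈Y → x∉X∩Y (x∈X , x∈Y)) in n , λ y xy → N⊆∁Y y xy ∘ proj₂
    ... | no  x∉X = let n , N⊆∁X = ¬X-open x x∉X in n , λ y xy → N⊆∁X y xy ∘ proj₁

  Layer-cover : ∀ {C x} n → Interior C n x → ∃ λ i → Layer C i x
  Layer-cover zero int = zero , int
  Layer-cover {C} {x} (suc n) int with em {Interior C n x}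
  ... | yes int′ = Layer-cover n int′
  ... | no  ¬int = suc n , int , ¬int

  Layer-partition : ∀ {C} → IsClopen C → IsClopenPartition C (Layer C)
  Layer-partition (C-open , _) =
    (λ i → invariant⇒clopen (Layer-invariant i)) ,
    (λ x x∈C → let n , int = C-open x x∈C in Layer-cover n int) ,
    (λ i _ Li → Interior⇒∈ (Layer⇒Interior i Li)) ,
    (λ i j _ → Layer-unique i j)

  ClopenIn : ℕ → Baire → Subset → Set
  ClopenIn ℓ a X = IsClopen X × (∀ x → X x → Agree ℓ a x)

  slice : ℕ → Baire → Subset → ℕ → Subset
  slice ℓ a X i = X ∩ Agree (suc ℓ) (a [ ℓ ]≔ i)

  ClopenIn-slice : ∀ {ℓ a X} → ClopenIn ℓ a X → ∀ i → ClopenIn (suc ℓ) (a [ ℓ ]≔ i) (slice ℓ a X i)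
  ClopenIn-slice (X-clopen , _) _ = clopen-∩ X-clopen clopen-agree , λ _ → proj₂

  slice-partition : ∀ {ℓ a X} → ClopenIn ℓ a X → IsClopenPartition X (slice ℓ a X)
  slice-partition {ℓ} {a} X∈ =
    (λ i → proj₁ (ClopenIn-slice X∈ i)) ,
    (λ x x∈X → x ℓ , x∈X , []≔-extend (proj₂ X∈ x x∈X)) ,
    (λ _ _ → proj₁) ,
    (λ i j x (_ , ix) (_ , jx) → trans (coordinate ix) (sym (coordinate jx)))
    where
    coordinate : ∀ {i x} → Agree (suc ℓ) (a [ ℓ ]≔ i) x → i ≡ x ℓ
    coordinate {i} ix = trans (sym ([]≔-at {ℓ} {a} {i})) (ix ℓ ≤-refl)

  module Resolution (E : Rel₂) where

    data Resolved (ℓ : ℕ) (a b : Baire) : Set where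
      homogeneous : Homogeneous E (Agree ℓ a) (Agree ℓ b) → Resolved ℓ a b
      refine      : (∀ i j → Resolved (suc ℓ) (a [ ℓ ]≔ i) (b [ ℓ ]≔ j)) → Resolved ℓ a b

    resolvedRank : ∀ {ℓ a b} → Resolved ℓ a b → Ord
    resolvedRank (homogeneous _) = zero
    resolvedRank (refine r)      = supSuc λ i j → resolvedRank (r i j)

    Resolved⇒RankLe : ∀ {ℓ a b X Y} (r : Resolved ℓ a b) → ClopenIn ℓ a X → ClopenIn ℓ b Y →
                      RankLe E (resolvedRank r) X Y
    Resolved⇒RankLe (homogeneous hom) (_ , X⊆) (_ , Y⊆) = inj₁ (lift (Homogeneous-⊆ hom X⊆ Y⊆))
    Resolved⇒RankLe (refine r) X∈ Y∈ =
      RankLe-partition (slice-partition X∈) (slice-partition Y∈) λ i j →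
        Resolved⇒RankLe (r i j) (ClopenIn-slice X∈ i) (ClopenIn-slice Y∈ j)

    unresolvedChild : ∀ {ℓ a b} → ¬ Resolved ℓ a b →
                      ∃₂ λ i j → ¬ Resolved (suc ℓ) (a [ ℓ ]≔ i) (b [ ℓ ]≔ j)
    unresolvedChild ¬r =
      let i , ¬∀j = ¬∀⇒∃¬ (¬r ∘ refine)
          j , ¬rij = ¬∀⇒∃¬ ¬∀j
      in i , j , ¬rij

    Unresolved : ℕ → Set
    Unresolved ℓ = Σ Baire λ a → Σ Baire λ b → ¬ Resolved ℓ a b

    extend : ∀ {ℓ} → Unresolved ℓ → Unresolved (suc ℓ)
    extend {ℓ} (a , b , ¬r) = let i , j , ¬r′ = unresolvedChild ¬r in a [ ℓ ]≔ i , b [ ℓ ]≔ j , ¬r′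

    branch : ∀ {ℓ} → Unresolved ℓ → (n : ℕ) → Unresolved (n + ℓ)
    branch u zero    = u
    branch u (suc n) = extend (branch u n)

    module _ (E-clopen : IsClopenGraph E) where

      homogeneousNear : ∀ {X Y} → ¬ X ≈ Y → ∃ λ N → ∀ {m a b} → N ≤ m →
                        ¬ Agree m a b → Agree m a X → Agree m b Y →
                        Homogeneous E (Agree m a) (Agree m b)
      homogeneousNear {X} {Y} X≉Y with em {E X Y}
      ... | yes EXY = let N , near = relOpen-homogeneousNear (proj₁ (proj₂ (proj₂ E-clopen))) X≉Y EXY
                      in N , λ N≤m ¬ab aX bY → inj₁ (near N≤m ¬ab aX bY)
      ... | no ¬EXY = let N , near = relOpen-homogeneousNear (proj₂ (proj₂ (proj₂ E-clopen))) X≉Y ¬EXY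
                      in N , λ N≤m ¬ab aX bY → inj₂ (near N≤m ¬ab aX bY)

      separated⇒Resolved : ∀ {ℓ a b} → ¬ Agree ℓ a b → Resolved ℓ a b
      separated⇒Resolved {ℓ} {a} {b} ¬ab = dne branch-absurd
        where
        branch-absurd : ¬ ¬ Resolved ℓ a b
        branch-absurd ¬r = proj₂ (proj₂ (branch u N)) (homogeneous (near (m≤m+n N ℓ) ¬ab-N xs-X ys-Y))
          where
          u : Unresolved ℓ
          u = a , b , ¬r
          xs ys : ℕ → Baire
          xs n = proj₁ (branch u n)
          ys n = proj₁ (proj₂ (branch u n))
          xs-coherent : Coherent ℓ xs
          xs-coherent _ = []≔-agree
          ys-coherent : Coherent ℓ ys
          ys-coherent _ = []≔-agree
          ¬ab-N : ∀ {n} → ¬ Agree (n + ℓ) (xs n) (ys n)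
          ¬ab-N {n} abN = agree-separated ¬ab (coherent-agree {m = n} xs-coherent z≤n)
                            (coherent-agree {m = n} ys-coherent z≤n) (agree-mono (m≤n+m ℓ n) abN)
          X≉Y : ¬ diagonal xs ≈ diagonal ys
          X≉Y = agree-separated ¬ab (diagonal-agree xs-coherent 0) (diagonal-agree ys-coherent 0) ∘ ≈⇒agree
          N = proj₁ (homogeneousNear X≉Y)
          near = proj₂ (homogeneousNear X≉Y)
          xs-X = diagonal-agree xs-coherent N
          ys-Y = diagonal-agree ys-coherent N

      agree⊎resolved : ∀ ℓ a b → Agree ℓ a b ⊎ Resolved ℓ a b
      agree⊎resolved ℓ a b with em {Agree ℓ a b}
      ... | yes ab = inj₁ ab
      ... | no ¬ab = inj₂ (separated⇒Resolved ¬ab)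

      descentRank : ℕ → ℕ → Baire → Baire → Ord
      descentRank zero    ℓ a b = [ const zero , resolvedRank ]′ (agree⊎resolved ℓ a b)
      descentRank (suc d) ℓ a b = supSuc λ i j → descentRank d (suc ℓ) (a [ ℓ ]≔ i) (b [ ℓ ]≔ j)

      descentRank-bound : ∀ d {ℓ a b X Y} → ClopenIn ℓ a X → ClopenIn ℓ b Y →
                          (∀ x y → X x → Y y → ¬ Agree (d + ℓ) x y) → RankLe E (descentRank d ℓ a b) X Y
      descentRank-bound zero {ℓ} {a} {b} X∈ Y∈ apart with agree⊎resolved ℓ a b
      ... | inj₂ r  = Resolved⇒RankLe r X∈ Y∈
      ... | inj₁ ab = inj₁ (lift (inj₁ λ x y x∈X y∈Y → ⊥-elim
                        (apart x y x∈X y∈Y (agree-trans (agree-sym (proj₂ X∈ x x∈X)) (agree-trans ab (proj₂ Y∈ y y∈Y))))))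
      descentRank-bound (suc d) {ℓ} X∈ Y∈ apart =
        RankLe-partition (slice-partition X∈) (slice-partition Y∈) λ i j →
          descentRank-bound d (ClopenIn-slice X∈ i) (ClopenIn-slice Y∈ j) λ x y x∈ y∈ →
            apart x y (proj₁ x∈) (proj₁ y∈) ∘ agree-mono (≤-reflexive (sym (+-suc d ℓ)))

lemma4 : ExcludedMiddle 0ℓ → ExcludedMiddle (Level.suc 0ℓ) →
    (E : Rel₂) → IsClopenGraph E →
    Σ Ord λ α → ∀ C D → IsClopen C → IsClopen D → Disjoint C D → RankLe E α C D
lemma4 em _ E E-clopen =
  supSuc (λ i j → descentRank E-clopen (i ⊔ j) 0 origin origin) ,
  λ C D C-clopen D-clopen C∩D=∅ →
    RankLe-partition (Layer-partition C-clopen) (Layer-partition D-clopen) λ i j →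
      descentRank-bound E-clopen (i ⊔ j) (clopenIn₀ (Layer-invariant i)) (clopenIn₀ (Layer-invariant j))
        λ x y x∈Li y∈Lj xy → C∩D=∅ y
          (Layer⇒Interior i x∈Li y (agree-mono (≤-trans (m≤m⊔n i j) (m≤m+n (i ⊔ j) 0)) xy))
          (Interior⇒∈ (Layer⇒Interior j y∈Lj))
  where
  open Classical em
  open Resolution E
  origin : Baire
  origin _ = 0
  clopenIn₀ : ∀ {n X} → Invariant n X → ClopenIn 0 origin X
  clopenIn₀ inv = invariant⇒clopen inv , λ _ _ _ ()
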